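{- For any two different partitions $\lambda\neq\mu$ of the same positive integer $k$, the simplicial complexes $K_\lambda$ and $K_\mu$ are not isomorphic (not combinatorially equivalent).
   Context: For $m\ge1$, $C_m$ denotes the chain $0<1<\cdots<m$. For a partition $\lambda=(\lambda_1,\ldots,\lambda_s)$ of $k$ (positive parts), $P_\lambda=C_{\lambda_1}\times\cdots\times C_{\lambda_s}$ with componentwise order, with minimum $\hat0$ and maximum $\hat1$, and $K_\lambda=\Delta(P_\lambda\setminus\{\hat0,\hat1\})$ is the order complex (faces = chains) of the proper part of $P_\lambda$. -}

module Defs where

open import Data.Bool using (Bool; true; false; _∧_; not; T)
open import Data.Nat using (ℕ; zero; suc; _≤_; _<_; _≤ᵇ_; _≡ᵇ_)
open import Data.List using (List; []; _∷_; map)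
open import Data.Nat.ListAction using (sum)
open import Data.List.Relation.Unary.All using (All)
open import Data.List.Relation.Unary.Linked using (Linked)
open import Data.List.Relation.Binary.Pointwise using (Pointwise)
open import Data.List.Membership.Propositional using (_∈_)
open import Data.Product using (Σ; proj₁; _×_)
open import Data.Sum using (_⊎_)
open import Data.Nat using (_≥_)
open import Relation.Binary.PropositionalEquality using (_≡_)
open import Function.Bundles using (_⤖_; _⇔_; Bijection)

IsPartition : ℕ → List ℕ → Set
IsPartition k parts = All (0 <_) parts × Linked _≥_ parts × sum parts ≡ k

-- Elements of P_λ = C_{λ1} × ... × C_{λs} are lists x of the same length
-- as λ with 0 ≤ x_i ≤ λ_i.  Boolean test for membership:
boundedB : List ℕ → List ℕ → Bool
boundedB [] [] = true
boundedB (a ∷ as) (b ∷ bs) = (a ≤ᵇ b) ∧ boundedB as bs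
boundedB [] (_ ∷ _) = false
boundedB (_ ∷ _) [] = false

eqListB : List ℕ → List ℕ → Bool
eqListB [] [] = true
eqListB (a ∷ as) (b ∷ bs) = (a ≡ᵇ b) ∧ eqListB as bs
eqListB [] (_ ∷ _) = false
eqListB (_ ∷ _) [] = false

allZeroB : List ℕ → Bool
allZeroB [] = true
allZeroB (a ∷ as) = (a ≡ᵇ 0) ∧ allZeroB as

-- x lies in the proper part P_λ ∖ {0̂, 1̂}
inProperB : List ℕ → List ℕ → Bool
inProperB parts x = boundedB x parts ∧ not (allZeroB x) ∧ not (eqListB x parts)

Vertex : List ℕ → Set
Vertex parts = Σ (List ℕ) (λ x → T (inProperB parts x))

_≼_ : ∀ {parts} → Vertex parts → Vertex parts → Set
x ≼ y = Pointwise _≤_ (proj₁ x) (proj₁ y)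

Comparable : ∀ {parts} → Vertex parts → Vertex parts → Set
Comparable x y = x ≼ y ⊎ y ≼ x

IsFace : (parts : List ℕ) → List (Vertex parts) → Set
IsFace parts xs = ∀ {x y} → x ∈ xs → y ∈ xs → Comparable {parts} x y

ComplexIso : List ℕ → List ℕ → Set
ComplexIso la mu =
  Σ (Vertex la ⤖ Vertex mu) λ f →
    ∀ (xs : List (Vertex la)) → IsFace la xs ⇔ IsFace mu (map (Bijection.to f) xs)

{-# OPTIONS --safe #-}
module Submission where

-- Isomorphic order complexes have isomorphic comparability graphs (the edges are the
-- two-element faces), so it suffices to read λ off the comparability graph of the proper
-- part of P_λ. With one part that graph is complete; with two parts λ₁ ≥ λ₂ its largest
-- antichain has λ₂ + 1 elements. Call u complemented if some v is incomparable to u and has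
-- no common neighbour with it: these are exactly the vertices all of whose coordinates are
-- 0 or full, so there are two of them for two parts and at least three for more. Call z a
-- twin of u if both are comparable to the same complemented vertices. With at least three
-- parts the atom λᵢeᵢ has the λᵢ points of its axis as twins, and so, via the
-- order-reversing involution x ↦ λ - x, has the opposite coatom; every other complemented
-- vertex is its own only twin. Hence for n ≥ 2 the number of complemented vertices with n
-- distinct twins is twice the number of parts ≥ n, and these numbers together with
-- |λ| = k determine λ.

open import Defs
open import Data.Bool using (true; false; T; not)
open import Data.Bool.Properties using (T-∧; T-irrelevant)
open import Data.Empty using (⊥; ⊥-elim)
open import Data.Fin as Fin using (Fin; toℕ; fromℕ<; splitAt)
import Data.Fin.Properties as Finₚ
open import Data.List using (List; []; _∷_; length; applyUpTo; filter)
open import Data.List.Properties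
  using (length-applyUpTo; length-filter; filter-none; filter-accept; filter-reject)
open import Data.List.Relation.Binary.Pointwise using (Pointwise; []; _∷_)
open import Data.List.Relation.Unary.Any using (here; there)
open import Data.List.Relation.Unary.All as All using (All; []; _∷_)
open import Data.List.Relation.Unary.Linked.Properties using (Linked⇒All)
open import Data.List.Relation.Unary.Linked as Linked using (Linked; []; _∷_)
open import Data.Nat
open import Data.Nat.Properties
open import Data.Nat.ListAction using (sum)
open import Data.Product using (Σ; ∃; ∃₂; _×_; _,_; proj₁; proj₂)
open import Data.Sum as Sum using (_⊎_; inj₁; inj₂; [_,_]′)
import Data.Sum.Properties as Sumₚ
open import Data.Unit using (tt)
open import Function using (_∘_; _∘₂_; id; case_of_)
open import Function.Bundles using (_⇔_; mk⇔; Equivalence; Bijection)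
open import Function.Construct.Composition using (_⇔-∘_)
open import Function.Construct.Symmetry using (⇔-sym)
open import Function.Definitions using (Injective)
open import Relation.Binary.PropositionalEquality
open import Relation.Binary.Definitions using (tri<; tri≈; tri>)
open import Relation.Nullary using (¬_; yes; no)
open import Relation.Nullary.Decidable using (¬?; _×-dec_; decidable-stable)

-- Graphs and the isomorphism invariants used

record Graph : Set₁ where
  constructor graph
  field
    Vtx : Set
    _~_ : Vtx → Vtx → Set

record _≅_ (G H : Graph) : Set where
  private
    module G = Graph G
    module H = Graph H
  field
    to      : G.Vtx → H.Vtx
    from    : H.Vtx → G.Vtx
    from∘to : ∀ x → from (to x) ≡ x
    to∘from : ∀ y → to (from y) ≡ y
    to-~    : ∀ {x y} → x G.~ y → to x H.~ to y
    to-~⁻   : ∀ {x y} → to x H.~ to y → x G.~ y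

  to-injective : Injective _≡_ _≡_ to
  to-injective {x} {y} eq = trans (sym (from∘to x)) (trans (cong from eq) (from∘to y))

  to-~-from : ∀ {x y} → to x H.~ y ⇔ x G.~ from y
  to-~-from {x} {y} = mk⇔
    (λ r → to-~⁻ (subst (to x H.~_) (sym (to∘from y)) r))
    (λ r → subst (to x H.~_) (to∘from y) (to-~ r))

≅-sym : ∀ {G H} → G ≅ H → H ≅ G
≅-sym {H = H} I = record
  { to = from ; from = to ; from∘to = to∘from ; to∘from = from∘to
  ; to-~ = λ r → to-~⁻ (subst₂ (Graph._~_ H) (sym (to∘from _)) (sym (to∘from _)) r)
  ; to-~⁻ = λ r → subst₂ (Graph._~_ H) (to∘from _) (to∘from _) (to-~ r) }
  where open _≅_ I

AtLeast : {A : Set} → ℕ → (A → Set) → Set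
AtLeast m P = Σ (Fin m → _) λ f → Injective _≡_ _≡_ f × (∀ i → P (f i))

module _ {A : Set} {P : A → Set} where

  AtLeast-map : ∀ {B : Set} {Q : B → Set} {m} (h : A → B) → Injective _≡_ _≡_ h →
                (∀ {x} → P x → Q (h x)) → AtLeast m P → AtLeast m Q
  AtLeast-map h h-inj P⇒Q (f , f-inj , Pf) = h ∘ f , f-inj ∘ h-inj , P⇒Q ∘ Pf

  AtLeast-weaken : ∀ {Q : A → Set} {m} → (∀ {x} → P x → Q x) → AtLeast m P → AtLeast m Q
  AtLeast-weaken = AtLeast-map id id

  AtLeast-≤ : ∀ {m b} (code : ∀ x → P x → Fin b) →
              (∀ {x y} (px : P x) (py : P y) → code x px ≡ code y py → x ≡ y) →
              AtLeast m P → m ≤ b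
  AtLeast-≤ code code-inj (f , f-inj , Pf) =
    Finₚ.injective⇒≤ (λ eq → f-inj (code-inj (Pf _) (Pf _) eq))

  AtLeast-+ : ∀ {m n} ((f , _) : AtLeast m P) ((g , _) : AtLeast n P) →
              (∀ i j → f i ≢ g j) → AtLeast (m + n) P
  AtLeast-+ {m} {n} (f , f-inj , Pf) (g , g-inj , Pg) f≢g =
    h , h-inj , [f,g]-P ∘ splitAt m
    where
    h : Fin (m + n) → A
    h k = [ f , g ]′ (splitAt m k)
    [f,g]-P : ∀ x → P ([ f , g ]′ x)
    [f,g]-P (inj₁ i) = Pf i
    [f,g]-P (inj₂ j) = Pg j
    [f,g]-inj : Injective _≡_ _≡_ [ f , g ]′
    [f,g]-inj {inj₁ i} {inj₁ j} eq = cong inj₁ (f-inj eq)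
    [f,g]-inj {inj₁ i} {inj₂ j} eq = ⊥-elim (f≢g i j eq)
    [f,g]-inj {inj₂ i} {inj₁ j} eq = ⊥-elim (f≢g j i (sym eq))
    [f,g]-inj {inj₂ i} {inj₂ j} eq = cong inj₂ (g-inj eq)
    h-inj : Injective _≡_ _≡_ h
    h-inj {k} {l} eq = begin
      k                           ≡⟨ Finₚ.join-splitAt m n k ⟨
      Fin.join m n (splitAt m k)  ≡⟨ cong (Fin.join m n) ([f,g]-inj {splitAt m k} {splitAt m l} eq) ⟩
      Fin.join m n (splitAt m l)  ≡⟨ Finₚ.join-splitAt m n l ⟩
      l                           ∎
      where open ≡-Reasoning

module _ (G : Graph) where
  open Graph G

  Antichain : ℕ → Set
  Antichain m = Σ (Fin m → Vtx) λ f → ∀ {i j} → i ≢ j → ¬ f i ~ f j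

  Complemented : Vtx → Set
  Complemented u = Σ Vtx λ v → ¬ u ~ v × (∀ w → u ~ w → v ~ w → ⊥)

  Twin : Vtx → Vtx → Set
  Twin u z = ∀ w → Complemented w → u ~ w ⇔ z ~ w

  TwinRich : ℕ → Vtx → Set
  TwinRich n u = Complemented u × AtLeast n (Twin u)

  Antichain-≤ : ∀ {m b} (code : Vtx → Fin b) → (∀ x y → code x ≡ code y → x ~ y) →
                Antichain m → m ≤ b
  Antichain-≤ code code-~ (f , anti) = Finₚ.injective⇒≤ inj
    where
    inj : Injective _≡_ _≡_ (code ∘ f)
    inj {i} {j} eq with i Fin.≟ j
    ... | yes i≡j = i≡j
    ... | no  i≢j = ⊥-elim (anti i≢j (code-~ (f i) (f j) eq))

module _ {G H : Graph} (I : G ≅ H) where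
  open _≅_ I

  Antichain-≅ : ∀ {m} → Antichain G m → Antichain H m
  Antichain-≅ (f , anti) = to ∘ f , λ i≢j r → anti i≢j (to-~⁻ r)

  Complemented-≅ : ∀ {u} → Complemented G u → Complemented H (to u)
  Complemented-≅ {u} (v , u≁v , no-common) = to v , (λ r → u≁v (to-~⁻ r)) ,
    λ w u~w v~w → no-common (from w) (Equivalence.to to-~-from u~w) (Equivalence.to to-~-from v~w)

Twin-≅ : ∀ {G H} (I : G ≅ H) {u z} → Twin G u z → Twin H (_≅_.to I u) (_≅_.to I z)
Twin-≅ I u≈z w cw =
  ⇔-sym to-~-from ⇔-∘ (u≈z (from w) (Complemented-≅ (≅-sym I) cw) ⇔-∘ to-~-from)
  where open _≅_ I

AtLeast-Complemented-≅ : ∀ {G H m} (I : G ≅ H) →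
                         AtLeast m (Complemented G) → AtLeast m (Complemented H)
AtLeast-Complemented-≅ {H = H} I =
  AtLeast-map {Q = Complemented H} to to-injective (λ {u} → Complemented-≅ I {u})
  where open _≅_ I

TwinRich-≅ : ∀ {G H} (I : G ≅ H) {n u} → TwinRich G n u → TwinRich H n (_≅_.to I u)
TwinRich-≅ {H = H} I {u = u} (cu , twins) =
  Complemented-≅ I cu , AtLeast-map {Q = Twin H (to u)} to to-injective (Twin-≅ I) twins
  where open _≅_ I

AtLeast-TwinRich-≅ : ∀ {G H m n} (I : G ≅ H) →
                     AtLeast m (TwinRich G n) → AtLeast m (TwinRich H n)
AtLeast-TwinRich-≅ {H = H} {n = n} I =
  AtLeast-map {Q = TwinRich H n} to to-injective (λ {u} → TwinRich-≅ I {u = u})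
  where open _≅_ I

-- Beyond the end of the list coord returns 0, so part j and x ‼ j vanish for j ≥ s.
coord : List ℕ → ℕ → ℕ
coord []       _       = 0
coord (a ∷ _)  zero    = a
coord (_ ∷ as) (suc j) = coord as j

coord-≥length : ∀ xs {j} → length xs ≤ j → coord xs j ≡ 0
coord-≥length []       _                 = refl
coord-≥length (_ ∷ xs) {suc j} (s≤s len≤j) = coord-≥length xs len≤j

coord-ext : ∀ {xs ys} → length xs ≡ length ys → (∀ j → coord xs j ≡ coord ys j) → xs ≡ ys
coord-ext {[]}     {[]}     _   _  = refl
coord-ext {_ ∷ xs} {_ ∷ ys} len eq = cong₂ _∷_ (eq 0) (coord-ext (suc-injective len) (eq ∘ suc))

coord-applyUpTo : ∀ g {n j} → j < n → coord (applyUpTo g n) j ≡ g j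
coord-applyUpTo g {suc n} {zero}  _         = refl
coord-applyUpTo g {suc n} {suc j} (s≤s j<n) = coord-applyUpTo (g ∘ suc) j<n

boundedB⇒coord≤ : ∀ xs ys → T (boundedB xs ys) →
                  length xs ≡ length ys × (∀ j → coord xs j ≤ coord ys j)
boundedB⇒coord≤ []       []       _ = refl , λ _ → z≤n
boundedB⇒coord≤ (a ∷ xs) (b ∷ ys) h
  with a≤b , rest ← Equivalence.to T-∧ h
  with len , xs≤ys ← boundedB⇒coord≤ xs ys rest =
  cong suc len , λ { zero → ≤ᵇ⇒≤ a b a≤b ; (suc j) → xs≤ys j }

coord≤⇒boundedB : ∀ xs ys → length xs ≡ length ys → (∀ j → coord xs j ≤ coord ys j) →
                  T (boundedB xs ys)
coord≤⇒boundedB []       []       _   _   = tt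
coord≤⇒boundedB (a ∷ xs) (b ∷ ys) len xs≤ys = Equivalence.from T-∧
  (≤⇒≤ᵇ (xs≤ys 0) , coord≤⇒boundedB xs ys (suc-injective len) (xs≤ys ∘ suc))

¬allZeroB⇒coord≢0 : ∀ xs → T (not (allZeroB xs)) → ∃ λ j → coord xs j ≢ 0
¬allZeroB⇒coord≢0 (zero  ∷ xs) h with j , xⱼ≢0 ← ¬allZeroB⇒coord≢0 xs h = suc j , xⱼ≢0
¬allZeroB⇒coord≢0 (suc _ ∷ xs) _ = 0 , λ ()

coord≢0⇒¬allZeroB : ∀ xs j → coord xs j ≢ 0 → T (not (allZeroB xs))
coord≢0⇒¬allZeroB []           _       xⱼ≢0 = xⱼ≢0 refl
coord≢0⇒¬allZeroB (zero  ∷ _)  zero    xⱼ≢0 = ⊥-elim (xⱼ≢0 refl)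
coord≢0⇒¬allZeroB (zero  ∷ xs) (suc j) xⱼ≢0 = coord≢0⇒¬allZeroB xs j xⱼ≢0
coord≢0⇒¬allZeroB (suc _ ∷ _)  _       _    = tt

¬eqListB⇒coord≢ : ∀ xs ys → length xs ≡ length ys → T (not (eqListB xs ys)) →
                  ∃ λ j → coord xs j ≢ coord ys j
¬eqListB⇒coord≢ []       []       _   ()
¬eqListB⇒coord≢ (a ∷ xs) (b ∷ ys) len h with a ≡ᵇ b in a≡ᵇb
... | false = 0 , λ a≡b → subst T a≡ᵇb (≡⇒≡ᵇ a b a≡b)
... | true  with j , differ ← ¬eqListB⇒coord≢ xs ys (suc-injective len) h = suc j , differ

coord≢⇒¬eqListB : ∀ xs ys j → coord xs j ≢ coord ys j → T (not (eqListB xs ys))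
coord≢⇒¬eqListB []       []       _       differ = differ refl
coord≢⇒¬eqListB []       (_ ∷ _)  _       _      = tt
coord≢⇒¬eqListB (_ ∷ _)  []       _       _      = tt
coord≢⇒¬eqListB (a ∷ xs) (b ∷ ys) j       differ with a ≡ᵇ b in a≡ᵇb
coord≢⇒¬eqListB (a ∷ xs) (b ∷ ys) zero    differ | true  =
  ⊥-elim (differ (≡ᵇ⇒≡ a b (subst T (sym a≡ᵇb) tt)))
coord≢⇒¬eqListB (a ∷ xs) (b ∷ ys) (suc j) differ | true  = coord≢⇒¬eqListB xs ys j differ
... | false = tt

Pointwise≤⇒coord≤ : ∀ {xs ys} → Pointwise _≤_ xs ys → ∀ j → coord xs j ≤ coord ys j
Pointwise≤⇒coord≤ []            _       = z≤n
Pointwise≤⇒coord≤ (x≤y ∷ _)     zero    = x≤y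
Pointwise≤⇒coord≤ (_ ∷ xs≤ys)   (suc j) = Pointwise≤⇒coord≤ xs≤ys j

coord≤⇒Pointwise≤ : ∀ {xs ys} → length xs ≡ length ys → (∀ j → coord xs j ≤ coord ys j) →
                    Pointwise _≤_ xs ys
coord≤⇒Pointwise≤ {[]}     {[]}     _   _     = []
coord≤⇒Pointwise≤ {_ ∷ _}  {_ ∷ _}  len xs≤ys =
  xs≤ys 0 ∷ coord≤⇒Pointwise≤ (suc-injective len) (xs≤ys ∘ suc)

All-coord : ∀ {P : ℕ → Set} {xs} → All P xs → ∀ {j} → j < length xs → P (coord xs j)
All-coord (px ∷ _)   {zero}  _         = px
All-coord (_  ∷ pxs) {suc j} (s≤s j<n) = All-coord pxs j<n

-- Counting the parts of a partition

countAtLeast : ℕ → List ℕ → ℕ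
countAtLeast n xs = length (filter (n ≤?_) xs)

coord≤head : ∀ {a xs} → Linked _≥_ (a ∷ xs) → ∀ i → coord (a ∷ xs) i ≤ a
coord≤head _                          zero    = ≤-refl
coord≤head {xs = []}    _             (suc i) = z≤n
coord≤head {xs = _ ∷ _} (a≥b ∷ dec)   (suc i) = ≤-trans (coord≤head dec i) a≥b

module _ {n : ℕ} where

  countAtLeast-head< : ∀ {a xs} → Linked _≥_ (a ∷ xs) → a < n → countAtLeast n (a ∷ xs) ≡ 0
  countAtLeast-head< dec a<n = cong length (filter-none (n ≤?_)
    (All.map (λ a≥x n≤x → <⇒≱ a<n (≤-trans n≤x a≥x))
             (Linked⇒All (λ a≥b b≥c → ≤-trans b≥c a≥b) ≤-refl dec)))

  countAtLeast-accept : ∀ {a xs} → n ≤ a → countAtLeast n (a ∷ xs) ≡ suc (countAtLeast n xs)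
  countAtLeast-accept n≤a = cong length (filter-accept (n ≤?_) n≤a)

  countAtLeast-reject : ∀ {a xs} → n ≰ a → countAtLeast n (a ∷ xs) ≡ countAtLeast n xs
  countAtLeast-reject n≰a = cong length (filter-reject (n ≤?_) n≰a)

  <countAtLeast⇒≤coord : ∀ {xs} → Linked _≥_ xs → ∀ {i} → i < countAtLeast n xs → n ≤ coord xs i
  <countAtLeast⇒≤coord {a ∷ xs} dec {i} i<c with n ≤? a | i
  ... | no  n≰a | i′     = ⊥-elim (<⇒≱ (subst (i′ <_) (countAtLeast-head< dec (≰⇒> n≰a)) i<c) z≤n)
  ... | yes n≤a | zero   = n≤a
  ... | yes n≤a | suc i′ = <countAtLeast⇒≤coord (Linked.tail dec)
                             (s≤s⁻¹ (subst (suc i′ <_) (countAtLeast-accept n≤a) i<c))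

  ≤coord⇒<countAtLeast : ∀ {xs} → Linked _≥_ xs → 0 < n →
                         ∀ {i} → n ≤ coord xs i → i < countAtLeast n xs
  ≤coord⇒<countAtLeast {[]}     _   0<n n≤0 = ⊥-elim (<⇒≱ 0<n n≤0)
  ≤coord⇒<countAtLeast {a ∷ xs} dec 0<n {i} n≤xᵢ with n ≤? a | i
  ... | no  n≰a | i′     = ⊥-elim (n≰a (≤-trans n≤xᵢ (coord≤head dec i′)))
  ... | yes n≤a | zero   = subst (0 <_) (sym (countAtLeast-accept n≤a)) (s≤s z≤n)
  ... | yes n≤a | suc i′ = subst (suc i′ <_) (sym (countAtLeast-accept n≤a))
                             (s≤s (≤coord⇒<countAtLeast (Linked.tail dec) 0<n n≤xᵢ))

SameCounts : List ℕ → List ℕ → Set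
SameCounts xs ys = ∀ n → 2 ≤ n → countAtLeast n xs ≡ countAtLeast n ys

SameCounts-tail : ∀ {a xs ys} → SameCounts (a ∷ xs) (a ∷ ys) → SameCounts xs ys
SameCounts-tail {a} {xs} {ys} same n 2≤n with n ≤? a
... | yes n≤a = suc-injective (begin
  suc (countAtLeast n xs)  ≡⟨ countAtLeast-accept n≤a ⟨
  countAtLeast n (a ∷ xs)  ≡⟨ same n 2≤n ⟩
  countAtLeast n (a ∷ ys)  ≡⟨ countAtLeast-accept n≤a ⟩
  suc (countAtLeast n ys)  ∎)
  where open ≡-Reasoning
... | no  n≰a = begin
  countAtLeast n xs        ≡⟨ countAtLeast-reject n≰a ⟨
  countAtLeast n (a ∷ xs)  ≡⟨ same n 2≤n ⟩
  countAtLeast n (a ∷ ys)  ≡⟨ countAtLeast-reject n≰a ⟩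
  countAtLeast n ys        ∎
  where open ≡-Reasoning

-- A head a ≥ 2 is a part ≥ a, so the other list has one too; a head ≤ 1 is below any part.
head-≤ : ∀ {a b xs ys} → 0 < b → Linked _≥_ (b ∷ ys) → SameCounts (a ∷ xs) (b ∷ ys) → a ≤ b
head-≤ {a} {b} {xs} 0<b dec same with 2 ≤? a
... | no  a≱2 = ≤-trans (s≤s⁻¹ (≰⇒> a≱2)) 0<b
... | yes 2≤a = <countAtLeast⇒≤coord dec {0}
  (subst (0 <_) (trans (sym (countAtLeast-accept {a} ≤-refl)) (same a 2≤a)) (s≤s z≤n))

≡-by-countAtLeast : ∀ {xs ys} → All (0 <_) xs → All (0 <_) ys → Linked _≥_ xs → Linked _≥_ ys →
                    sum xs ≡ sum ys → SameCounts xs ys → xs ≡ ys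
≡-by-countAtLeast {[]}     {[]}     _ _ _ _ _ _ = refl
≡-by-countAtLeast {[]}     {b ∷ ys} _ (0<b ∷ _) _ _ Σ≡ _ =
  ⊥-elim (<⇒≢ (<-≤-trans 0<b (m≤m+n b (sum ys))) Σ≡)
≡-by-countAtLeast {a ∷ xs} {[]}     (0<a ∷ _) _ _ _ Σ≡ _ =
  ⊥-elim (<⇒≢ (<-≤-trans 0<a (m≤m+n a (sum xs))) (sym Σ≡))
≡-by-countAtLeast {a ∷ xs} {b ∷ ys} (0<a ∷ posx) (0<b ∷ posy) decx decy Σ≡ same
  with refl ← ≤-antisym (head-≤ 0<b decy same) (head-≤ 0<a decx (sym ∘₂ same)) =
  cong (a ∷_) (≡-by-countAtLeast posx posy (Linked.tail decx) (Linked.tail decy)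
                 (+-cancelˡ-≡ a _ _ Σ≡) (SameCounts-tail same))

-- The proper part of P_λ and its comparability graph

module Product (p : List ℕ) where

  s : ℕ
  s = length p

  part : ℕ → ℕ
  part = coord p

  V : Set
  V = Vertex p

  _‼_ : V → ℕ → ℕ
  x ‼ j = coord (proj₁ x) j

  private
    unpack : (x : V) → T (boundedB (proj₁ x) p) × T (not (allZeroB (proj₁ x))) ×
                       T (not (eqListB (proj₁ x) p))
    unpack (_ , h) with bounded , h′ ← Equivalence.to T-∧ h = bounded , Equivalence.to T-∧ h′

  length-vertex : ∀ x → length (proj₁ x) ≡ s
  length-vertex x = proj₁ (boundedB⇒coord≤ (proj₁ x) p (proj₁ (unpack x)))

  ‼-≤-part : ∀ x j → x ‼ j ≤ part j
  ‼-≤-part x = proj₂ (boundedB⇒coord≤ (proj₁ x) p (proj₁ (unpack x)))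

  nonzero-coordinate : ∀ x → ∃ λ j → x ‼ j ≢ 0
  nonzero-coordinate x = ¬allZeroB⇒coord≢0 (proj₁ x) (proj₁ (proj₂ (unpack x)))

  nonfull-coordinate : ∀ x → ∃ λ j → x ‼ j ≢ part j
  nonfull-coordinate x = ¬eqListB⇒coord≢ (proj₁ x) p (length-vertex x) (proj₂ (proj₂ (unpack x)))

  vertex-ext : ∀ {x y} → (∀ j → x ‼ j ≡ y ‼ j) → x ≡ y
  vertex-ext {x@(xs , hx)} {y@(ys , hy)} eq
    with refl ← coord-ext {xs} {ys} (trans (length-vertex x) (sym (length-vertex y))) eq =
    cong (xs ,_) (T-irrelevant hx hy)

  ‼-beyond : ∀ x {j} → s ≤ j → x ‼ j ≡ 0
  ‼-beyond x {j} s≤j = n≤0⇒n≡0 (subst (x ‼ j ≤_) (coord-≥length p s≤j) (‼-≤-part x j))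

  ‼≢0⇒<s : ∀ x {j} → x ‼ j ≢ 0 → j < s
  ‼≢0⇒<s x xⱼ≢0 = ≰⇒> (xⱼ≢0 ∘ ‼-beyond x)

  record ProperPoint (g : ℕ → ℕ) : Set where
    field
      bounded : ∀ j → g j ≤ part j
      nonzero : ∃ λ j → g j ≢ 0
      nonfull : ∃ λ j → g j ≢ part j

  module _ {g : ℕ → ℕ} (pg : ProperPoint g) where
    open ProperPoint pg

    private
      applyUpTo-coord : ∀ j → coord (applyUpTo g s) j ≡ g j
      applyUpTo-coord j with j <? s
      ... | yes j<s = coord-applyUpTo g j<s
      ... | no  j≮s = begin
        coord (applyUpTo g s) j  ≡⟨ coord-≥length (applyUpTo g s) length≤j ⟩
        0                        ≡⟨ n≤0⇒n≡0 (subst (g j ≤_) (coord-≥length p (≮⇒≥ j≮s)) (bounded j)) ⟨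
        g j                      ∎
        where
        open ≡-Reasoning
        length≤j : length (applyUpTo g s) ≤ j
        length≤j = subst (_≤ j) (sym (length-applyUpTo g s)) (≮⇒≥ j≮s)

    vertex : V
    vertex = applyUpTo g s , Equivalence.from T-∧
      ( coord≤⇒boundedB (applyUpTo g s) p (length-applyUpTo g s)
          (λ j → subst (_≤ part j) (sym (applyUpTo-coord j)) (bounded j))
      , Equivalence.from T-∧
          ( coord≢0⇒¬allZeroB (applyUpTo g s) (proj₁ nonzero)
              (proj₂ nonzero ∘ trans (sym (applyUpTo-coord _)))
          , coord≢⇒¬eqListB (applyUpTo g s) p (proj₁ nonfull)
              (proj₂ nonfull ∘ trans (sym (applyUpTo-coord _))) ) )

    vertex-‼ : ∀ j → vertex ‼ j ≡ g j
    vertex-‼ = applyUpTo-coord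

  _≤ᵥ_ : V → V → Set
  x ≤ᵥ y = ∀ j → x ‼ j ≤ y ‼ j

  _≶_ : V → V → Set
  x ≶ y = x ≤ᵥ y ⊎ y ≤ᵥ x

  Comparability : Graph
  Comparability = graph V _≶_

  ≶-refl : ∀ x → x ≶ x
  ≶-refl x = inj₁ (λ _ → ≤-refl)

  ≶-sym : ∀ {x y} → x ≶ y → y ≶ x
  ≶-sym = Sum.swap

  ≤ᵥ-within : ∀ x y → (∀ j → j < s → x ‼ j ≤ y ‼ j) → x ≤ᵥ y
  ≤ᵥ-within x y x≤y j with j <? s
  ... | yes j<s = x≤y j j<s
  ... | no  j≮s = subst (_≤ y ‼ j) (sym (‼-beyond x (≮⇒≥ j≮s))) z≤n

  Comparable⇔≶ : ∀ {x y} → Comparable {p} x y ⇔ x ≶ y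
  Comparable⇔≶ {x} {y} = mk⇔
    (Sum.map Pointwise≤⇒coord≤ Pointwise≤⇒coord≤)
    (Sum.map (coord≤⇒Pointwise≤ x≈y) (coord≤⇒Pointwise≤ (sym x≈y)))
    where
    x≈y : length (proj₁ x) ≡ length (proj₁ y)
    x≈y = trans (length-vertex x) (sym (length-vertex y))

  pair-face⇔≶ : ∀ x y → IsFace p (x ∷ y ∷ []) ⇔ x ≶ y
  pair-face⇔≶ x y = mk⇔ (λ face → to (Comparable⇔≶ {x} {y}) (face (here refl) (there (here refl))))
                        face
    where
    open Equivalence using (to; from)
    face : x ≶ y → IsFace p (x ∷ y ∷ [])
    face x≶y (here refl)         (here refl)         = from (Comparable⇔≶ {x} {x}) (≶-refl x)
    face x≶y (here refl)         (there (here refl)) = from (Comparable⇔≶ {x} {y}) x≶y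
    face x≶y (there (here refl)) (here refl)         = from (Comparable⇔≶ {y} {x}) (≶-sym {x} {y} x≶y)
    face x≶y (there (here refl)) (there (here refl)) = from (Comparable⇔≶ {y} {y}) (≶-refl y)

  ≤ᵥ-trans : ∀ {x y z} → x ≤ᵥ y → y ≤ᵥ z → x ≤ᵥ z
  ≤ᵥ-trans x≤y y≤z j = ≤-trans (x≤y j) (y≤z j)

  ¬≤ᵥbottom : ∀ w → ¬ (∀ j → w ‼ j ≤ 0)
  ¬≤ᵥbottom w w≤0 with j , wⱼ≢0 ← nonzero-coordinate w = wⱼ≢0 (n≤0⇒n≡0 (w≤0 j))

  ¬top≤ᵥ : ∀ w → ¬ (∀ j → part j ≤ w ‼ j)
  ¬top≤ᵥ w top≤w with j , wⱼ≢top ← nonfull-coordinate w =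
    wⱼ≢top (≤-antisym (‼-≤-part w j) (top≤w j))

  properAt : ∀ {g j} → (∀ i → g i ≤ part i) → g j ≢ 0 → g j ≢ part j → ProperPoint g
  properAt {j = j} bounded gⱼ≢0 gⱼ≢top = record
    { bounded = bounded ; nonzero = j , gⱼ≢0 ; nonfull = j , gⱼ≢top }

  Binary : V → Set
  Binary u = ∀ j → u ‼ j ≡ 0 ⊎ u ‼ j ≡ part j

  binary-≢0 : ∀ u → Binary u → ∀ {j} → u ‼ j ≢ 0 → u ‼ j ≡ part j
  binary-≢0 u bu {j} uⱼ≢0 = [ ⊥-elim ∘ uⱼ≢0 , id ]′ (bu j)

  binary-≢top : ∀ u → Binary u → ∀ {j} → u ‼ j ≢ part j → u ‼ j ≡ 0
  binary-≢top u bu {j} uⱼ≢top = [ id , ⊥-elim ∘ uⱼ≢top ]′ (bu j)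

  -- A coordinate strictly inside (0, part j) lets the meet or the join of u and v be a
  -- vertex comparable to both.
  complemented⇒binary : ∀ u → Complemented Comparability u → Binary u
  complemented⇒binary u (v , _ , no-common) j with u ‼ j ≟ 0 | u ‼ j ≟ part j
  ... | yes uⱼ≡0 | _          = inj₁ uⱼ≡0
  ... | no _     | yes uⱼ≡top = inj₂ uⱼ≡top
  ... | no uⱼ≢0  | no uⱼ≢top  with u ‼ j ≤? v ‼ j
  ... | yes uⱼ≤vⱼ = ⊥-elim (no-common meet (inj₂ meet≤u) (inj₂ meet≤v))
    where
    meetⱼ≡uⱼ : u ‼ j ⊓ v ‼ j ≡ u ‼ j
    meetⱼ≡uⱼ = m≤n⇒m⊓n≡m uⱼ≤vⱼ
    meetPoint : ProperPoint (λ i → u ‼ i ⊓ v ‼ i)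
    meetPoint = properAt (λ i → ≤-trans (m⊓n≤m _ _) (‼-≤-part u i))
                         (uⱼ≢0 ∘ trans (sym meetⱼ≡uⱼ)) (uⱼ≢top ∘ trans (sym meetⱼ≡uⱼ))
    meet : V
    meet = vertex meetPoint
    meet≤u : meet ≤ᵥ u
    meet≤u i = subst (_≤ u ‼ i) (sym (vertex-‼ meetPoint i)) (m⊓n≤m (u ‼ i) (v ‼ i))
    meet≤v : meet ≤ᵥ v
    meet≤v i = subst (_≤ v ‼ i) (sym (vertex-‼ meetPoint i)) (m⊓n≤n (u ‼ i) (v ‼ i))
  ... | no uⱼ≰vⱼ = ⊥-elim (no-common join (inj₁ u≤join) (inj₁ v≤join))
    where
    joinⱼ≡uⱼ : u ‼ j ⊔ v ‼ j ≡ u ‼ j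
    joinⱼ≡uⱼ = m≥n⇒m⊔n≡m (<⇒≤ (≰⇒> uⱼ≰vⱼ))
    joinPoint : ProperPoint (λ i → u ‼ i ⊔ v ‼ i)
    joinPoint = properAt (λ i → ⊔-lub (‼-≤-part u i) (‼-≤-part v i))
                         (uⱼ≢0 ∘ trans (sym joinⱼ≡uⱼ)) (uⱼ≢top ∘ trans (sym joinⱼ≡uⱼ))
    join : V
    join = vertex joinPoint
    u≤join : u ≤ᵥ join
    u≤join i = subst (u ‼ i ≤_) (sym (vertex-‼ joinPoint i)) (m≤m⊔n (u ‼ i) (v ‼ i))
    v≤join : v ≤ᵥ join
    v≤join i = subst (v ‼ i ≤_) (sym (vertex-‼ joinPoint i)) (m≤n⊔m (u ‼ i) (v ‼ i))

  dualPoint : ∀ x → ProperPoint (λ j → part j ∸ x ‼ j)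
  dualPoint x = record
    { bounded = λ j → m∸n≤m (part j) (x ‼ j)
    ; nonzero = let j , xⱼ≢top = nonfull-coordinate x in
                j , λ eq → xⱼ≢top (≤-antisym (‼-≤-part x j) (m∸n≡0⇒m≤n eq))
    ; nonfull = let j , xⱼ≢0 = nonzero-coordinate x in
                j , <⇒≢ (∸-monoʳ-< (n≢0⇒n>0 xⱼ≢0) (‼-≤-part x j))
    }

  dual : V → V
  dual x = vertex (dualPoint x)

  dual-‼ : ∀ x j → dual x ‼ j ≡ part j ∸ x ‼ j
  dual-‼ x = vertex-‼ (dualPoint x)

  dual-involutive : ∀ x → dual (dual x) ≡ x
  dual-involutive x = vertex-ext λ j → begin
    dual (dual x) ‼ j          ≡⟨ dual-‼ (dual x) j ⟩
    part j ∸ dual x ‼ j        ≡⟨ cong (part j ∸_) (dual-‼ x j) ⟩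
    part j ∸ (part j ∸ x ‼ j)  ≡⟨ m∸[m∸n]≡n (‼-≤-part x j) ⟩
    x ‼ j                      ∎
    where open ≡-Reasoning

  dual-antitone : ∀ {x y} → x ≤ᵥ y → dual y ≤ᵥ dual x
  dual-antitone {x} {y} x≤y j =
    subst₂ _≤_ (sym (dual-‼ y j)) (sym (dual-‼ x j)) (∸-monoʳ-≤ (part j) (x≤y j))

  dual-≶ : ∀ {x y} → x ≶ y → dual x ≶ dual y
  dual-≶ {x} {y} = Sum.swap ∘ Sum.map (dual-antitone {x} {y}) (dual-antitone {y} {x})

  dualIso : Comparability ≅ Comparability
  dualIso = record
    { to = dual ; from = dual ; from∘to = dual-involutive ; to∘from = dual-involutive
    ; to-~ = λ {x} {y} → dual-≶ {x} {y}
    ; to-~⁻ = λ {x} {y} r →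
        subst₂ _≶_ (dual-involutive x) (dual-involutive y) (dual-≶ {dual x} {dual y} r)
    }

  dual-injective : Injective _≡_ _≡_ dual
  dual-injective = _≅_.to-injective dualIso

  -- A common upper (lower) bound of u and dual u would be 1̂ (0̂).
  binary⇒complemented : ∀ u → Binary u → Complemented Comparability u
  binary⇒complemented u bu = dual u , u≁dual , no-common
    where
    split : ∀ j → (u ‼ j ≡ 0 × dual u ‼ j ≡ part j) ⊎ (u ‼ j ≡ part j × dual u ‼ j ≡ 0)
    split j with bu j
    ... | inj₁ uⱼ≡0   = inj₁ (uⱼ≡0 , trans (dual-‼ u j) (cong (part j ∸_) uⱼ≡0))
    ... | inj₂ uⱼ≡top =
      inj₂ (uⱼ≡top , trans (dual-‼ u j) (trans (cong (part j ∸_) uⱼ≡top) (n∸n≡0 (part j))))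
    below-both : ∀ w → w ≤ᵥ u → w ≤ᵥ dual u → ⊥
    below-both w w≤u w≤d = ¬≤ᵥbottom w λ j → case split j of λ where
      (inj₁ (uⱼ≡0 , _)) → subst (w ‼ j ≤_) uⱼ≡0 (w≤u j)
      (inj₂ (_ , dⱼ≡0)) → subst (w ‼ j ≤_) dⱼ≡0 (w≤d j)
    above-both : ∀ w → u ≤ᵥ w → dual u ≤ᵥ w → ⊥
    above-both w u≤w d≤w = ¬top≤ᵥ w λ j → case split j of λ where
      (inj₁ (_ , dⱼ≡top)) → subst (_≤ w ‼ j) dⱼ≡top (d≤w j)
      (inj₂ (uⱼ≡top , _)) → subst (_≤ w ‼ j) uⱼ≡top (u≤w j)
    u≁dual : ¬ u ≶ dual u
    u≁dual (inj₁ u≤d) = below-both u (λ _ → ≤-refl) u≤d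
    u≁dual (inj₂ d≤u) = below-both (dual u) d≤u (λ _ → ≤-refl)
    no-common : ∀ w → u ≶ w → dual u ≶ w → ⊥
    no-common w (inj₁ u≤w) (inj₁ d≤w) = above-both w u≤w d≤w
    no-common w (inj₂ w≤u) (inj₂ w≤d) = below-both w w≤u w≤d
    no-common w (inj₁ u≤w) (inj₂ w≤d) = u≁dual (inj₁ (≤ᵥ-trans {u} {w} {dual u} u≤w w≤d))
    no-common w (inj₂ w≤u) (inj₁ d≤w) = u≁dual (inj₂ (≤ᵥ-trans {dual u} {w} {u} d≤w w≤u))

  Axial : ℕ → V → Set
  Axial i x = ∀ j → j ≢ i → x ‼ j ≡ 0

  axial-‼≢0 : ∀ {i} x → Axial i x → x ‼ i ≢ 0
  axial-‼≢0 {i} x ax xᵢ≡0 with j , xⱼ≢0 ← nonzero-coordinate x with j ≟ i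
  ... | yes refl = xⱼ≢0 xᵢ≡0
  ... | no  j≢i  = xⱼ≢0 (ax j j≢i)

  axial-ext : ∀ {i} x y → Axial i x → Axial i y → x ‼ i ≡ y ‼ i → x ≡ y
  axial-ext {i} x y ax ay xᵢ≡yᵢ = vertex-ext λ j → case j ≟ i of λ where
    (yes refl) → xᵢ≡yᵢ
    (no  j≢i)  → trans (ax j j≢i) (sym (ay j j≢i))

  axial-binary-unique : ∀ {i} x y → Binary x → Binary y → Axial i x → Axial i y → x ≡ y
  axial-binary-unique x y bx by ax ay = axial-ext x y ax ay
    (trans (binary-≢0 x bx (axial-‼≢0 x ax)) (sym (binary-≢0 y by (axial-‼≢0 y ay))))

  axial-≁ : ∀ {i j} x y → i ≢ j → Axial i x → Axial j y → ¬ x ≶ y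
  axial-≁ {i} {j} x y i≢j ax ay (inj₁ x≤y) =
    axial-‼≢0 x ax (n≤0⇒n≡0 (subst (x ‼ i ≤_) (ay i i≢j) (x≤y i)))
  axial-≁ {i} {j} x y i≢j ax ay (inj₂ y≤x) =
    axial-‼≢0 y ay (n≤0⇒n≡0 (subst (y ‼ j ≤_) (ax j (i≢j ∘ sym)) (y≤x j)))

  axial-≶-binary : ∀ {i} x w → Axial i x → Binary w → x ≶ w ⇔ w ‼ i ≡ part i
  axial-≶-binary {i} x w ax bw = mk⇔ ≶⇒full full⇒≤
    where
    ≶⇒full : x ≶ w → w ‼ i ≡ part i
    ≶⇒full (inj₁ x≤w) = binary-≢0 w bw λ wᵢ≡0 →
      axial-‼≢0 x ax (n≤0⇒n≡0 (subst (x ‼ i ≤_) wᵢ≡0 (x≤w i)))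
    ≶⇒full (inj₂ w≤x) = binary-≢0 w bw λ wᵢ≡0 → ¬≤ᵥbottom w λ j → case j ≟ i of λ where
      (yes refl) → ≤-reflexive wᵢ≡0
      (no  j≢i)  → subst (w ‼ j ≤_) (ax j j≢i) (w≤x j)
    full⇒≤ : w ‼ i ≡ part i → x ≶ w
    full⇒≤ wᵢ≡top = inj₁ λ j → case j ≟ i of λ where
      (yes refl) → subst (x ‼ j ≤_) (sym wᵢ≡top) (‼-≤-part x i)
      (no  j≢i)  → subst (_≤ w ‼ j) (sym (ax j j≢i)) z≤n

  axial-twin : ∀ {i} x y → Axial i x → Axial i y → Twin Comparability x y
  axial-twin x y ax ay w cw = ⇔-sym (axial-≶-binary y w ay bw) ⇔-∘ axial-≶-binary x w ax bw
    where bw = complemented⇒binary w cw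

  AtLeast-axial-≤ : ∀ {i n} → AtLeast n (Axial i) → n ≤ part i
  AtLeast-axial-≤ {i} = AtLeast-≤ code code-inj
    where
    code : ∀ x → Axial i x → Fin (part i)
    code x ax = fromℕ< {pred (x ‼ i)}
      (subst (_≤ part i) (sym (suc-pred (x ‼ i) {{≢-nonZero (axial-‼≢0 x ax)}})) (‼-≤-part x i))
    code-inj : ∀ {x y} (ax : Axial i x) (ay : Axial i y) → code x ax ≡ code y ay → x ≡ y
    code-inj {x} {y} ax ay eq = axial-ext x y ax ay
      (pred-injective {{≢-nonZero (axial-‼≢0 x ax)}} {{≢-nonZero (axial-‼≢0 y ay)}}
        (Finₚ.fromℕ<-injective _ _ _ _ eq))

  TwoNonzero : V → Set
  TwoNonzero u = ∃₂ λ i i′ → i ≢ i′ × u ‼ i ≢ 0 × u ‼ i′ ≢ 0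

  axial⊎twoNonzero : ∀ u → (∃ λ i → Axial i u) ⊎ TwoNonzero u
  axial⊎twoNonzero u with i , uᵢ≢0 ← nonzero-coordinate u
    with anyUpTo? (λ j → ¬? (j ≟ i) ×-dec ¬? (u ‼ j ≟ 0)) s
  ... | yes (j , _ , j≢i , uⱼ≢0) = inj₂ (j , i , j≢i , uⱼ≢0 , uᵢ≢0)
  ... | no  none = inj₁ (i , λ j j≢i → decidable-stable (u ‼ j ≟ 0) λ uⱼ≢0 →
          none (j , ‼≢0⇒<s u uⱼ≢0 , j≢i , uⱼ≢0))

axis : ℕ → ℕ → ℕ → ℕ
axis i t j with j ≟ i
... | yes _ = t
... | no  _ = 0

axis-≡ : ∀ i t → axis i t i ≡ t
axis-≡ i t with i ≟ i
... | yes _   = refl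
... | no  i≢i = ⊥-elim (i≢i refl)

axis-≢ : ∀ {i j} t → j ≢ i → axis i t j ≡ 0
axis-≢ {i} {j} t j≢i with j ≟ i
... | yes j≡i = ⊥-elim (j≢i j≡i)
... | no  _   = refl

other : ℕ → ℕ
other zero    = 1
other (suc _) = 0

other-≢ : ∀ i → other i ≢ i
other-≢ zero    ()
other-≢ (suc _) ()

other-<2 : ∀ i → other i < 2
other-<2 zero    = s≤s (s≤s z≤n)
other-<2 (suc _) = s≤s z≤n

module Axes (p : List ℕ) (pos : All (0 <_) p) (2≤s : 2 ≤ length p) where
  open Product p

  part>0 : ∀ {j} → j < s → 0 < part j
  part>0 = All-coord pos

  part-≢0 : ∀ {j} → j < s → part j ≢ 0
  part-≢0 = n>0⇒n≢0 ∘ part>0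

  axisProper : ∀ i t → 0 < t → t ≤ part i → ProperPoint (axis i t)
  axisProper i t 0<t t≤partᵢ = record
    { bounded = bounded
    ; nonzero = i , λ eq → n>0⇒n≢0 0<t (trans (sym (axis-≡ i t)) eq)
    ; nonfull = other i , λ eq → part-≢0 (<-≤-trans (other-<2 i) 2≤s)
                                   (trans (sym eq) (axis-≢ t (other-≢ i)))
    }
    where
    bounded : ∀ j → axis i t j ≤ part j
    bounded j with j ≟ i
    ... | yes refl = t≤partᵢ
    ... | no  _    = z≤n

  axisPoint : ∀ i t → 0 < t → t ≤ part i → V
  axisPoint i t 0<t t≤partᵢ = vertex (axisProper i t 0<t t≤partᵢ)

  module _ {i t} (0<t : 0 < t) (t≤partᵢ : t ≤ part i) where

    axisPoint-‼ : axisPoint i t 0<t t≤partᵢ ‼ i ≡ t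
    axisPoint-‼ = trans (vertex-‼ (axisProper i t 0<t t≤partᵢ) i) (axis-≡ i t)

    axisPoint-axial : Axial i (axisPoint i t 0<t t≤partᵢ)
    axisPoint-axial j j≢i = trans (vertex-‼ (axisProper i t 0<t t≤partᵢ) j) (axis-≢ t j≢i)

  atom : ∀ i → i < s → V
  atom i i<s = axisPoint i (part i) (part>0 i<s) ≤-refl

  module _ {i} (i<s : i < s) where

    atom-‼ : atom i i<s ‼ i ≡ part i
    atom-‼ = axisPoint-‼ (part>0 i<s) ≤-refl

    atom-axial : Axial i (atom i i<s)
    atom-axial = axisPoint-axial (part>0 i<s) ≤-refl

    atom-binary : Binary (atom i i<s)
    atom-binary j with j ≟ i
    ... | yes refl = inj₂ atom-‼
    ... | no  j≢i  = inj₁ (atom-axial j j≢i)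

    atom-complemented : Complemented Comparability (atom i i<s)
    atom-complemented = binary⇒complemented (atom i i<s) atom-binary

  atom-twins : ∀ {i n} (i<s : i < s) → n ≤ part i → AtLeast n (Twin Comparability (atom i i<s))
  atom-twins {i} {n} i<s n≤partᵢ = point , point-injective , λ t →
    axial-twin (atom i i<s) (point t) (atom-axial i<s) (axisPoint-axial (s≤s z≤n) (height≤ t))
    where
    height≤ : ∀ t → suc (toℕ t) ≤ part i
    height≤ t = ≤-trans (Finₚ.toℕ<n t) n≤partᵢ
    point : Fin n → V
    point t = axisPoint i (suc (toℕ t)) (s≤s z≤n) (height≤ t)
    point-injective : Injective _≡_ _≡_ point
    point-injective {t} {t′} eq = Finₚ.toℕ-injective (suc-injective (begin
      suc (toℕ t)     ≡⟨ axisPoint-‼ (s≤s z≤n) (height≤ t) ⟨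
      point t ‼ i     ≡⟨ cong (_‼ i) eq ⟩
      point t′ ‼ i    ≡⟨ axisPoint-‼ (s≤s z≤n) (height≤ t′) ⟩
      suc (toℕ t′)    ∎))
      where open ≡-Reasoning

  atom-≁ : ∀ {i j} (i<s : i < s) (j<s : j < s) → i ≢ j → ¬ atom i i<s ≶ atom j j<s
  atom-≁ {i} {j} i<s j<s i≢j = axial-≁ (atom i i<s) (atom j j<s) i≢j (atom-axial i<s) (atom-axial j<s)

  atom-injective : ∀ {i j} (i<s : i < s) (j<s : j < s) → atom i i<s ≡ atom j j<s → i ≡ j
  atom-injective {i} {j} i<s j<s eq =
    decidable-stable (i ≟ j) λ i≢j →
      atom-≁ i<s j<s i≢j (subst (atom i i<s ≶_) eq (≶-refl (atom i i<s)))

  toℕ<s : ∀ {c} → c ≤ s → (k : Fin c) → toℕ k < s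
  toℕ<s c≤s k = <-≤-trans (Finₚ.toℕ<n k) c≤s

  atoms : ∀ {c} → c ≤ s → Fin c → V
  atoms c≤s k = atom (toℕ k) (toℕ<s c≤s k)

  atoms-axial : ∀ {c} (c≤s : c ≤ s) k → Axial (toℕ k) (atoms c≤s k)
  atoms-axial c≤s k = atom-axial (toℕ<s c≤s k)

  atoms-complemented : ∀ {c} (c≤s : c ≤ s) k → Complemented Comparability (atoms c≤s k)
  atoms-complemented c≤s k = atom-complemented (toℕ<s c≤s k)

  atoms-injective : ∀ {c} (c≤s : c ≤ s) → Injective _≡_ _≡_ (atoms c≤s)
  atoms-injective c≤s {k} {l} eq =
    Finₚ.toℕ-injective (atom-injective (toℕ<s c≤s k) (toℕ<s c≤s l) eq)

  antichain₂ : Antichain Comparability 2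
  antichain₂ = atoms 2≤s , λ {i} {j} i≢j →
    axial-≁ (atoms 2≤s i) (atoms 2≤s j) (i≢j ∘ Finₚ.toℕ-injective)
            (atoms-axial 2≤s i) (atoms-axial 2≤s j)

  atom≤ᵥbinary : ∀ u → Binary u → ∀ {j} (uⱼ≢0 : u ‼ j ≢ 0) → atom j (‼≢0⇒<s u uⱼ≢0) ≤ᵥ u
  atom≤ᵥbinary u bu {j} uⱼ≢0 m with m ≟ j
  ... | yes refl = subst₂ _≤_ (sym (atom-‼ (‼≢0⇒<s u uⱼ≢0))) (sym (binary-≢0 u bu uⱼ≢0)) ≤-refl
  ... | no  m≢j  = subst (_≤ u ‼ m) (sym (atom-axial (‼≢0⇒<s u uⱼ≢0) m m≢j)) z≤n

  -- z cannot lie below two atoms (it would be 0̂), nor above the second while below the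
  -- first (their supports are disjoint).
  ≶-atoms⇒atom≤ᵥ : ∀ {j j′} (j<s : j < s) (j′<s : j′ < s) z → j ≢ j′ →
                   z ≶ atom j j<s → z ≶ atom j′ j′<s → atom j j<s ≤ᵥ z
  ≶-atoms⇒atom≤ᵥ j<s j′<s z j≢j′ (inj₂ a≤z) _ = a≤z
  ≶-atoms⇒atom≤ᵥ {j} {j′} j<s j′<s z j≢j′ (inj₁ z≤a) (inj₂ a′≤z) =
    ⊥-elim (part-≢0 j′<s (n≤0⇒n≡0 (begin
      part j′               ≡⟨ sym (atom-‼ j′<s) ⟩
      atom j′ j′<s ‼ j′     ≤⟨ a′≤z j′ ⟩
      z ‼ j′                ≤⟨ z≤a j′ ⟩
      atom j j<s ‼ j′       ≡⟨ atom-axial j<s j′ (j≢j′ ∘ sym) ⟩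
      0                     ∎)))
    where open ≤-Reasoning
  ≶-atoms⇒atom≤ᵥ {j} {j′} j<s j′<s z j≢j′ (inj₁ z≤a) (inj₁ z≤a′) = ⊥-elim (¬≤ᵥbottom z λ m →
    case m ≟ j of λ where
      (yes refl) → subst (z ‼ m ≤_) (atom-axial j′<s m j≢j′) (z≤a′ m)
      (no  m≢j)  → subst (z ‼ m ≤_) (atom-axial j<s m m≢j) (z≤a m))

  twin-≥-at : ∀ u z → Binary u → Twin Comparability u z →
              ∀ {j j′} → j′ ≢ j → u ‼ j′ ≢ 0 → u ‼ j ≢ 0 → u ‼ j ≤ z ‼ j
  twin-≥-at u z bu u≈z {j} {j′} j′≢j uⱼ′≢0 uⱼ≢0 = begin
    u ‼ j           ≡⟨ binary-≢0 u bu uⱼ≢0 ⟩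
    part j          ≡⟨ sym (atom-‼ j<s) ⟩
    atom j j<s ‼ j  ≤⟨ ≶-atoms⇒atom≤ᵥ j<s j′<s z (j′≢j ∘ sym) (z≶ uⱼ≢0) (z≶ uⱼ′≢0) j ⟩
    z ‼ j           ∎
    where
    open ≤-Reasoning
    j<s = ‼≢0⇒<s u uⱼ≢0
    j′<s = ‼≢0⇒<s u uⱼ′≢0
    z≶ : ∀ {m} (uₘ≢0 : u ‼ m ≢ 0) → z ≶ atom m (‼≢0⇒<s u uₘ≢0)
    z≶ {m} uₘ≢0 =
      Equivalence.to (u≈z (atom m m<s) (atom-complemented m<s)) (inj₂ (atom≤ᵥbinary u bu uₘ≢0))
      where m<s = ‼≢0⇒<s u uₘ≢0

  twin-≥ : ∀ u z → Binary u → TwoNonzero u → Twin Comparability u z → u ≤ᵥ z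
  twin-≥ u z bu (i , i′ , i≢i′ , uᵢ≢0 , uᵢ′≢0) u≈z j with u ‼ j ≟ 0 | j ≟ i
  ... | yes uⱼ≡0 | _        = subst (_≤ z ‼ j) (sym uⱼ≡0) z≤n
  ... | no  uⱼ≢0 | yes refl = twin-≥-at u z bu u≈z (i≢i′ ∘ sym) uᵢ′≢0 uⱼ≢0
  ... | no  uⱼ≢0 | no  j≢i  = twin-≥-at u z bu u≈z (j≢i ∘ sym) uᵢ≢0 uⱼ≢0

  dual-binary : ∀ u → Binary u → Binary (dual u)
  dual-binary u bu =
    complemented⇒binary (dual u) (Complemented-≅ dualIso {u} (binary⇒complemented u bu))

  twin-≤ : ∀ u z → Binary u → TwoNonzero (dual u) → Twin Comparability u z → z ≤ᵥ u
  twin-≤ u z bu twoᵈ u≈z = subst₂ _≤ᵥ_ (dual-involutive z) (dual-involutive u)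
    (dual-antitone {dual u} {dual z}
      (twin-≥ (dual u) (dual z) (dual-binary u bu) twoᵈ (Twin-≅ dualIso {u} {z} u≈z)))

  twin-rigid : ∀ u z → Binary u → TwoNonzero u → TwoNonzero (dual u) → Twin Comparability u z → z ≡ u
  twin-rigid u z bu two twoᵈ u≈z = vertex-ext λ j →
    ≤-antisym (twin-≤ u z bu twoᵈ u≈z j) (twin-≥ u z bu two u≈z j)

  AtLeast-twin-rigid-≤ : ∀ {n} u → Binary u → TwoNonzero u → TwoNonzero (dual u) →
                         AtLeast n (Twin Comparability u) → n ≤ 1
  AtLeast-twin-rigid-≤ u bu two twoᵈ = AtLeast-≤ (λ _ _ → Fin.zero) λ {x} {y} u≈x u≈y _ →
    trans (twin-rigid u x bu two twoᵈ u≈x) (sym (twin-rigid u y bu two twoᵈ u≈y))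

  AtLeast-twin-axial-≤ : ∀ {i n} u → Axial i u → Binary u → TwoNonzero (dual u) →
                         AtLeast n (Twin Comparability u) → n ≤ part i
  AtLeast-twin-axial-≤ {i} u ax bu twoᵈ twins =
    AtLeast-axial-≤ (AtLeast-weaken {Q = Axial i} (λ {z} → twin⇒axial {z}) twins)
    where
    twin⇒axial : ∀ {z} → Twin Comparability u z → Axial i z
    twin⇒axial {z} u≈z j j≢i = n≤0⇒n≡0 (subst (z ‼ j ≤_) (ax j j≢i) (twin-≤ u z bu twoᵈ u≈z j))

-- Three or more parts

third : ∀ i l → ∃ λ k → k < 3 × k ≢ i × k ≢ l
third 0             0             = 1 , s≤s (s≤s z≤n) , (λ ()) , (λ ())
third 0             1             = 2 , ≤-refl        , (λ ()) , (λ ())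
third 0             (suc (suc _)) = 1 , s≤s (s≤s z≤n) , (λ ()) , (λ ())
third 1             0             = 2 , ≤-refl        , (λ ()) , (λ ())
third 1             1             = 0 , s≤s z≤n       , (λ ()) , (λ ())
third 1             (suc (suc _)) = 0 , s≤s z≤n       , (λ ()) , (λ ())
third (suc (suc _)) 0             = 1 , s≤s (s≤s z≤n) , (λ ()) , (λ ())
third (suc (suc _)) 1             = 0 , s≤s z≤n       , (λ ()) , (λ ())
third (suc (suc _)) (suc (suc _)) = 0 , s≤s z≤n       , (λ ()) , (λ ())

module ThreeParts (p : List ℕ) (pos : All (0 <_) p) (3≤s : 3 ≤ length p) where
  open Product p
  open Axes p pos (≤-trans (n≤1+n 2) 3≤s)

  -- Some coordinate k < 3 is neither i nor l, and there u would be both 0 and full.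
  ¬axial×dual-axial : ∀ {i l} u → Axial i u → Axial l (dual u) → ⊥
  ¬axial×dual-axial {i} {l} u ax axᵈ with k , k<3 , k≢i , k≢l ← third i l =
    part-≢0 (<-≤-trans k<3 3≤s) (begin
      part k             ≡⟨ cong (part k ∸_) (ax k k≢i) ⟨
      part k ∸ u ‼ k     ≡⟨ dual-‼ u k ⟨
      dual u ‼ k         ≡⟨ axᵈ k k≢l ⟩
      0                  ∎)
    where open ≡-Reasoning

  AtLeast-3-complemented : AtLeast 3 (Complemented Comparability)
  AtLeast-3-complemented = atoms 3≤s , atoms-injective 3≤s , atoms-complemented 3≤s

  -- For binary u, Axial i u says that u is the atom on axis i, and Axial i (dual u) that u
  -- is the coatom opposite to it.
  AtomOrCoatom : ℕ → V → Set
  AtomOrCoatom n u = (∃ λ i → n ≤ part i × Axial i u) ⊎ (∃ λ i → n ≤ part i × Axial i (dual u))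

  -- Only atoms and coatoms can have two or more twins; the twins of the atom on axis i are
  -- the points of that axis, so there are at most part i of them.
  twinRich⇒atomOrCoatom : ∀ {n} u → 2 ≤ n → TwinRich Comparability n u → AtomOrCoatom n u
  twinRich⇒atomOrCoatom {n} u 2≤n (cu , twins) =
    classify (axial⊎twoNonzero u) (axial⊎twoNonzero (dual u))
    where
    bu = complemented⇒binary u cu
    classify : (∃ λ i → Axial i u) ⊎ TwoNonzero u →
               (∃ λ i → Axial i (dual u)) ⊎ TwoNonzero (dual u) → AtomOrCoatom n u
    classify (inj₁ (i , ax)) (inj₁ (l , axᵈ)) = ⊥-elim (¬axial×dual-axial u ax axᵈ)
    classify (inj₁ (i , ax)) (inj₂ twoᵈ)      = inj₁ (i , AtLeast-twin-axial-≤ u ax bu twoᵈ twins , ax)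
    classify (inj₂ two)      (inj₁ (l , axᵈ)) = inj₂ (l , n≤partₗ , axᵈ)
      where
      n≤partₗ = AtLeast-twin-axial-≤ (dual u) axᵈ (dual-binary u bu)
        (subst TwoNonzero (sym (dual-involutive u)) two)
        (proj₂ (TwinRich-≅ dualIso {u = u} (cu , twins)))
    classify (inj₂ two)      (inj₂ twoᵈ)      =
      ⊥-elim (<⇒≱ 2≤n (AtLeast-twin-rigid-≤ u bu two twoᵈ twins))

  module _ (dec : Linked _≥_ p) {n} (0<n : 0 < n) where

    private
      c = countAtLeast n p

    atomOrCoatomIndex : ∀ u → AtomOrCoatom n u → Fin c ⊎ Fin c
    atomOrCoatomIndex _ (inj₁ (_ , n≤partᵢ , _)) = inj₁ (fromℕ< (≤coord⇒<countAtLeast dec 0<n n≤partᵢ))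
    atomOrCoatomIndex _ (inj₂ (_ , n≤partᵢ , _)) = inj₂ (fromℕ< (≤coord⇒<countAtLeast dec 0<n n≤partᵢ))

    atomOrCoatomIndex-injective : ∀ u v → Binary u → Binary v →
                                  (su : AtomOrCoatom n u) (sv : AtomOrCoatom n v) →
                           atomOrCoatomIndex u su ≡ atomOrCoatomIndex v sv → u ≡ v
    atomOrCoatomIndex-injective u v bu bv (inj₁ (i , _ , ax)) (inj₁ (j , _ , ay)) eq
      with refl ← Finₚ.fromℕ<-injective i j _ _ (Sumₚ.inj₁-injective eq) =
      axial-binary-unique u v bu bv ax ay
    atomOrCoatomIndex-injective u v bu bv (inj₂ (i , _ , ax)) (inj₂ (j , _ , ay)) eq
      with refl ← Finₚ.fromℕ<-injective i j _ _ (Sumₚ.inj₂-injective eq) =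
      dual-injective (axial-binary-unique (dual u) (dual v) (dual-binary u bu) (dual-binary v bv) ax ay)
    atomOrCoatomIndex-injective u v bu bv (inj₁ _) (inj₂ _) ()
    atomOrCoatomIndex-injective u v bu bv (inj₂ _) (inj₁ _) ()

    AtLeast-twinRich-≤ : ∀ {m} → 2 ≤ n → AtLeast m (TwinRich Comparability n) → m ≤ c + c
    AtLeast-twinRich-≤ 2≤n = AtLeast-≤ code λ {u} {v} tru trv eq → atomOrCoatomIndex-injective u v
        (complemented⇒binary u (proj₁ tru)) (complemented⇒binary v (proj₁ trv))
        (classify u tru) (classify v trv)
        (trans (sym (Finₚ.splitAt-join c c _)) (trans (cong (splitAt c) eq) (Finₚ.splitAt-join c c _)))
      where
      classify : ∀ u → TwinRich Comparability n u → AtomOrCoatom n u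
      classify u = twinRich⇒atomOrCoatom u 2≤n
      code : ∀ u → TwinRich Comparability n u → Fin (c + c)
      code u tr = Fin.join c c (atomOrCoatomIndex u (classify u tr))

    AtLeast-twinRich : AtLeast (c + c) (TwinRich Comparability n)
    AtLeast-twinRich = AtLeast-+ {P = TwinRich Comparability n} atomsRich coatomsRich atom≢coatom
      where
      c≤s : c ≤ s
      c≤s = length-filter (n ≤?_) p
      atomsRich : AtLeast c (TwinRich Comparability n)
      atomsRich = atoms c≤s , atoms-injective c≤s , λ k →
        atoms-complemented c≤s k ,
        atom-twins (toℕ<s c≤s k) (<countAtLeast⇒≤coord dec (Finₚ.toℕ<n k))
      coatomsRich : AtLeast c (TwinRich Comparability n)
      coatomsRich = AtLeast-TwinRich-≅ dualIso atomsRich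
      atom≢coatom : ∀ k l → atoms c≤s k ≢ dual (atoms c≤s l)
      atom≢coatom k l eq = ¬axial×dual-axial (atoms c≤s l) (atoms-axial c≤s l)
        (subst (Axial (toℕ k)) eq (atoms-axial c≤s k))

-- One and two parts

module OnePart (a : ℕ) where
  open Product (a ∷ [])

  chain : ∀ x y → x ≶ y
  chain x y with ≤-total (x ‼ 0) (y ‼ 0)
  ... | inj₁ x₀≤y₀ = inj₁ (≤ᵥ-within x y λ { zero _ → x₀≤y₀ ; (suc _) (s≤s ()) })
  ... | inj₂ y₀≤x₀ = inj₂ (≤ᵥ-within y x λ { zero _ → y₀≤x₀ ; (suc _) (s≤s ()) })

  antichain-≤ : ∀ {m} → Antichain Comparability m → m ≤ 1
  antichain-≤ = Antichain-≤ Comparability (λ _ → Fin.zero) (λ x y _ → chain x y)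

module TwoParts (a b : ℕ) (b≤a : b ≤ a) (0<b : 0 < b) where
  open Product (a ∷ b ∷ [])

  0<a : 0 < a
  0<a = ≤-trans 0<b b≤a

  antidiagonal : ℕ → ℕ → ℕ
  antidiagonal j 0             = a ∸ j
  antidiagonal j 1             = j
  antidiagonal j (suc (suc _)) = 0

  antidiagonal-bounded : ∀ {j} → j ≤ b → ∀ i → antidiagonal j i ≤ part i
  antidiagonal-bounded {j} _   0             = m∸n≤m a j
  antidiagonal-bounded     j≤b 1             = j≤b
  antidiagonal-bounded     _   (suc (suc _)) = z≤n

  antidiagonalPoint : ∀ j → j ≤ b → ProperPoint (antidiagonal j)
  antidiagonalPoint zero    j≤b = record
    { bounded = antidiagonal-bounded j≤b ; nonzero = 0 , n>0⇒n≢0 0<a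
    ; nonfull = 1 , n>0⇒n≢0 0<b ∘ sym }
  antidiagonalPoint (suc j) j<b = record
    { bounded = antidiagonal-bounded j<b ; nonzero = 1 , λ ()
    ; nonfull = 0 , <⇒≢ (∸-monoʳ-< (s≤s z≤n) (≤-trans j<b b≤a)) }

  antidiagonalVertex : ∀ {j} → j ≤ b → V
  antidiagonalVertex {j} j≤b = vertex (antidiagonalPoint j j≤b)

  antidiagonal-≁ : ∀ {i j} (i≤b : i ≤ b) (j≤b : j ≤ b) → i < j →
                   ¬ antidiagonalVertex i≤b ≶ antidiagonalVertex j≤b
  antidiagonal-≁ {i} {j} i≤b j≤b i<j (inj₁ x≤y) = <⇒≱ (∸-monoʳ-< i<j (≤-trans j≤b b≤a))
    (subst₂ _≤_ (vertex-‼ (antidiagonalPoint i i≤b) 0) (vertex-‼ (antidiagonalPoint j j≤b) 0)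
                (x≤y 0))
  antidiagonal-≁ {i} {j} i≤b j≤b i<j (inj₂ y≤x) = <⇒≱ i<j
    (subst₂ _≤_ (vertex-‼ (antidiagonalPoint j j≤b) 1) (vertex-‼ (antidiagonalPoint i i≤b) 1)
                (y≤x 1))

  antichain : Antichain Comparability (suc b)
  antichain = point , λ {k} {l} → point-≁ k l
    where
    k≤b : ∀ (k : Fin (suc b)) → toℕ k ≤ b
    k≤b k = s≤s⁻¹ (Finₚ.toℕ<n k)
    point : Fin (suc b) → V
    point k = antidiagonalVertex (k≤b k)
    point-≁ : ∀ k l → k ≢ l → ¬ point k ≶ point l
    point-≁ k l k≢l with <-cmp (toℕ k) (toℕ l)
    ... | tri< k<l _ _ = antidiagonal-≁ (k≤b k) (k≤b l) k<l
    ... | tri≈ _ k≡l _ = ⊥-elim (k≢l (Finₚ.toℕ-injective k≡l))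
    ... | tri> _ _ l<k = antidiagonal-≁ (k≤b l) (k≤b k) l<k ∘ ≶-sym {point k} {point l}

  antichain-≤ : ∀ {m} → Antichain Comparability m → m ≤ suc b
  antichain-≤ = Antichain-≤ Comparability code code-≶
    where
    code : V → Fin (suc b)
    code x = fromℕ< (s≤s (‼-≤-part x 1))
    code-≶ : ∀ x y → code x ≡ code y → x ≶ y
    code-≶ x y eq with x₁≡y₁ ← Finₚ.fromℕ<-injective _ _ _ _ eq with ≤-total (x ‼ 0) (y ‼ 0)
    ... | inj₁ x₀≤y₀ = inj₁ (≤ᵥ-within x y λ where
      0 _ → x₀≤y₀
      1 _ → ≤-reflexive x₁≡y₁
      (suc (suc _)) (s≤s (s≤s ())))
    ... | inj₂ y₀≤x₀ = inj₂ (≤ᵥ-within y x λ where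
      0 _ → y₀≤x₀
      1 _ → ≤-reflexive (sym x₁≡y₁)
      (suc (suc _)) (s≤s (s≤s ())))

  binary⇒axial : ∀ u → Binary u → ∃ λ i → i < 2 × Axial i u
  binary⇒axial u bu with u ‼ 0 ≟ 0
  ... | yes u₀≡0 = 1 , ≤-refl , λ where
    0             _   → u₀≡0
    1             1≢1 → ⊥-elim (1≢1 refl)
    (suc (suc j)) _   → ‼-beyond u (s≤s (s≤s z≤n))
  ... | no  u₀≢0 = 0 , s≤s z≤n , λ where
    0             0≢0 → ⊥-elim (0≢0 refl)
    1             _   → binary-≢top u bu λ u₁≡b → ¬top≤ᵥ u λ where
      0             → ≤-reflexive (sym (binary-≢0 u bu u₀≢0))
      1             → ≤-reflexive (sym u₁≡b)
      (suc (suc _)) → z≤n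
    (suc (suc j)) _   → ‼-beyond u (s≤s (s≤s z≤n))

  ¬AtLeast-3-complemented : ¬ AtLeast 3 (Complemented Comparability)
  ¬AtLeast-3-complemented = 1+n≰n ∘ AtLeast-≤ code code-inj
    where
    code : ∀ u → Complemented Comparability u → Fin 2
    code u cu = fromℕ< (proj₁ (proj₂ (binary⇒axial u (complemented⇒binary u cu))))
    code-inj : ∀ {u v} (cu : Complemented Comparability u) (cv : Complemented Comparability v) →
               code u cu ≡ code v cv → u ≡ v
    code-inj {u} {v} cu cv eq = axial-binary-unique u v bu bv (proj₂ (proj₂ axu))
      (subst (λ k → Axial k v) (sym (Finₚ.fromℕ<-injective _ _ _ _ eq)) (proj₂ (proj₂ axv)))
      where
      bu = complemented⇒binary u cu
      bv = complemented⇒binary v cv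
      axu = binary⇒axial u bu
      axv = binary⇒axial v bv

open Product using (Comparability)

comparabilityIso : ∀ {la mu} → ComplexIso la mu → Comparability la ≅ Comparability mu
comparabilityIso {la} {mu} (f , faces) = record
  { to = to ; from = from ; from∘to = λ x → injective (to∘from (to x)) ; to∘from = to∘from
  ; to-~  = λ {x} {y} → Equivalence.to (≶⇔≶ x y)
  ; to-~⁻ = λ {x} {y} → Equivalence.from (≶⇔≶ x y)
  }
  where
  open Bijection f using (to; injective; surjective)
  open Product using (_≶_) renaming (pair-face⇔≶ to edge)
  from : Vertex mu → Vertex la
  from y = proj₁ (surjective y)
  to∘from : ∀ y → to (from y) ≡ y
  to∘from y = proj₂ (surjective y) refl
  ≶⇔≶ : ∀ x y → _≶_ la x y ⇔ _≶_ mu (to x) (to y)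
  ≶⇔≶ x y = edge mu (to x) (to y) ⇔-∘ (faces (x ∷ y ∷ []) ⇔-∘ ⇔-sym (edge la x y))

≇-one-vs-more-parts : ∀ {a b c r} → All (0 <_) (b ∷ c ∷ r) →
                      ¬ Comparability (a ∷ []) ≅ Comparability (b ∷ c ∷ r)
≇-one-vs-more-parts {a} pos I =
  1+n≰n (OnePart.antichain-≤ a (Antichain-≅ (≅-sym I) (Axes.antichain₂ _ pos (s≤s (s≤s z≤n)))))

≇-two-vs-more-parts : ∀ {a b c d e r} → b ≤ a → 0 < b → All (0 <_) (c ∷ d ∷ e ∷ r) →
                      ¬ Comparability (a ∷ b ∷ []) ≅ Comparability (c ∷ d ∷ e ∷ r)
≇-two-vs-more-parts {a} {b} b≤a 0<b pos I = TwoParts.¬AtLeast-3-complemented a b b≤a 0<b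
  (AtLeast-Complemented-≅ (≅-sym I) (ThreeParts.AtLeast-3-complemented _ pos (s≤s (s≤s (s≤s z≤n)))))

≅-two-parts⇒≡second : ∀ {a b a′ b′} → b ≤ a → 0 < b → b′ ≤ a′ → 0 < b′ →
                      Comparability (a ∷ b ∷ []) ≅ Comparability (a′ ∷ b′ ∷ []) → b ≡ b′
≅-two-parts⇒≡second {a} {b} {a′} {b′} b≤a 0<b b′≤a′ 0<b′ I = suc-injective (≤-antisym
  (TwoParts.antichain-≤ a′ b′ b′≤a′ 0<b′ (Antichain-≅ I (TwoParts.antichain a b b≤a 0<b)))
  (TwoParts.antichain-≤ a b b≤a 0<b (Antichain-≅ (≅-sym I) (TwoParts.antichain a′ b′ b′≤a′ 0<b′))))

≅-many-parts⇒SameCounts : ∀ {xs ys} → All (0 <_) xs → All (0 <_) ys →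
                          Linked _≥_ xs → Linked _≥_ ys → 3 ≤ length xs → 3 ≤ length ys →
                          Comparability xs ≅ Comparability ys → SameCounts xs ys
≅-many-parts⇒SameCounts {xs} {ys} posx posy decx decy 3≤s 3≤t I n 2≤n = ≤-antisym
  (doubled-≤ (upper ys posy 3≤t decy (AtLeast-TwinRich-≅ I (lower xs posx 3≤s decx))))
  (doubled-≤ (upper xs posx 3≤s decx (AtLeast-TwinRich-≅ (≅-sym I) (lower ys posy 3≤t decy))))
  where
  0<n = <-trans (s≤s z≤n) 2≤n
  doubled-≤ : ∀ {m m′} → m + m ≤ m′ + m′ → m ≤ m′
  doubled-≤ h = ≮⇒≥ λ m′<m → <⇒≱ (+-mono-< m′<m m′<m) h
  lower : ∀ p → All (0 <_) p → 3 ≤ length p → Linked _≥_ p →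
          AtLeast (countAtLeast n p + countAtLeast n p) (TwinRich (Comparability p) n)
  lower p pos 3≤s dec = ThreeParts.AtLeast-twinRich p pos 3≤s dec 0<n
  upper : ∀ p → All (0 <_) p → 3 ≤ length p → Linked _≥_ p → ∀ {m} →
          AtLeast m (TwinRich (Comparability p) n) → m ≤ countAtLeast n p + countAtLeast n p
  upper p pos 3≤s dec = ThreeParts.AtLeast-twinRich-≤ p pos 3≤s dec 0<n 2≤n

≅⇒≡-partitions : ∀ {k xs ys} → 1 ≤ k → IsPartition k xs → IsPartition k ys →
                 Comparability xs ≅ Comparability ys → xs ≡ ys
≅⇒≡-partitions 1≤k ([] , _ , refl) _ _ = ⊥-elim (1+n≰n 1≤k)
≅⇒≡-partitions {xs = _ ∷ _} 1≤k _ ([] , _ , refl) _ = ⊥-elim (1+n≰n 1≤k)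
≅⇒≡-partitions {xs = a ∷ []} {a′ ∷ []} _ (_ , _ , Σx) (_ , _ , Σy) _ =
  cong (_∷ []) (+-cancelʳ-≡ 0 a a′ (trans Σx (sym Σy)))
≅⇒≡-partitions {xs = _ ∷ []} {_ ∷ _ ∷ _} _ _ (posy , _) I =
  ⊥-elim (≇-one-vs-more-parts posy I)
≅⇒≡-partitions {xs = _ ∷ _ ∷ _} {_ ∷ []} _ (posx , _) _ I =
  ⊥-elim (≇-one-vs-more-parts posx (≅-sym I))
≅⇒≡-partitions {xs = a ∷ b ∷ []} {a′ ∷ b′ ∷ []} _
               (_ ∷ 0<b ∷ _ , b≤a ∷ _ , Σx) (_ ∷ 0<b′ ∷ _ , b′≤a′ ∷ _ , Σy) I
  with refl ← ≅-two-parts⇒≡second b≤a 0<b b′≤a′ 0<b′ I =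
  cong (_∷ b ∷ []) (+-cancelʳ-≡ (b + 0) a a′ (trans Σx (sym Σy)))
≅⇒≡-partitions {xs = _ ∷ _ ∷ []} {_ ∷ _ ∷ _ ∷ _} _ (_ ∷ 0<b ∷ _ , b≤a ∷ _ , _) (posy , _) I =
  ⊥-elim (≇-two-vs-more-parts b≤a 0<b posy I)
≅⇒≡-partitions {xs = _ ∷ _ ∷ _ ∷ _} {_ ∷ _ ∷ []} _ (posx , _) (_ ∷ 0<b ∷ _ , b≤a ∷ _ , _) I =
  ⊥-elim (≇-two-vs-more-parts b≤a 0<b posx (≅-sym I))
≅⇒≡-partitions {xs = _ ∷ _ ∷ _ ∷ _} {_ ∷ _ ∷ _ ∷ _} _ (posx , decx , Σx) (posy , decy , Σy) I =
  ≡-by-countAtLeast posx posy decx decy (trans Σx (sym Σy))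
    (≅-many-parts⇒SameCounts posx posy decx decy (s≤s (s≤s (s≤s z≤n))) (s≤s (s≤s (s≤s z≤n))) I)

mainTheorem5 : (k : ℕ) → 1 ≤ k → (la mu : List ℕ) →
    IsPartition k la → IsPartition k mu → la ≢ mu → ¬ ComplexIso la mu
mainTheorem5 k 1≤k la mu partλ partμ la≢mu iso =
  la≢mu (≅⇒≡-partitions 1≤k partλ partμ (comparabilityIso iso))
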